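{- Assume the setting described in the context. For every $v\in\{0,\dots,\tau-1\}$ the digits satisfy $d_{v,0}=s_v$, $b_{v,0}=r_{v-1}$, and for every integer $u\ge1$, $$d_{v,u}\equiv \left[l^{e_v}\right]^{ -1}\left(d_{v+1,u-1}-b_{v+u,u-1}\right)\pmod{m^{f_{v+u}}},$$ $$b_{v,u}\equiv \left[-m^{f_{v-1}}\right]^{ -1}\left(d_{v-u,u-1}-b_{v-1,u-1}\right)\pmod{l^{e_{v-u-1}}},$$ where $[x]^{ -1}$ denotes the inverse of $x$ modulo the indicated modulus.
   Context: Setting. Let $m,l\ge 2$ be coprime integers and $\tau\ge1$ an integer. Let $f_0,\dots,f_{\tau-1}$ be positive integers. Let $(a_{v,i})$, $v\in\{0,\dots,\tau-1\}$, $i\in\{0,\dots,l-1\}$, be integers with $a_{v,0}=0$ and, for $i\neq0$: $a_{v,i}\equiv -m^{f_v}i \pmod l$, $a_{v,i}\not\equiv0\pmod m$ and $a_{v,i}\not\equiv 0\pmod l$. For each $v\in\{0,\dots,\tau-1\}$ fix an admissible choice: an index $i_v\in\{1,\dots,l-1\}$, with $a_v:=a_{v,i_v}$; an integer $s_v$ with $1\le s_v\le m^{f_v}-1$ and $\gcd(s_v,m)=1$; and positive integers $e_v,r_v$ with $r_v\equiv i_v\pmod l$, $l^{e_v}s_v=m^{f_v}r_v+a_v$, and $|a_v|<\max(m^{f_v},l^{e_v})$. All indexed quantities are extended $\tau$-periodically to all integer indices. Iterates. Let $\mathbb Z_{\langle m,l\rangle}$ be the subring of $\mathbb Q$ of fractions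 whose denominators are coprime to both $m$ and $l$. Let $(n_v)_{v\in\mathbb Z}$ be a $\tau$-periodic sequence in $\mathbb Z_{\langle m,l\rangle}$ with $n_v\equiv s_v\pmod{m^{f_v}}$ and $n_{v+1}=l^{e_v}\frac{n_v-s_v}{m^{f_v}}+r_v$ for all $v$. Graded digits. $k_{v,0}=n_v$, $k_{v,u}=m^{f_{v+u}}k_{v,u+1}+d_{v,u}$ with $d_{v,u}\in\{0,\dots,m^{f_{v+u}}-1\}$, $k_{v,u+1}\in\mathbb Z_{\langle m,l\rangle}$ (so $d_{v,u}$ is the $u$-th digit of $n_v$ in the graded $m$-adic expansion $n_v=\sum_{u\ge0}d_{v,u}m^{f_v+\dots+f_{v+u-1}}$); $j_{v,0}=n_v$, $j_{v,u}=l^{e_{v-1-u}}j_{v,u+1}+b_{v,u}$ with $b_{v,u}\in\{0,\dots,l^{e_{v-1-u}}-1\}$, $j_{v,u+1}\in\mathbb Z_{\langle m,l\rangle}$ (so $b_{v,u}$ is the $u$-th digit of $n_v$ in the graded $l$-adic expansion $n_v=\sum_{u\ge0}b_{v,u}l^{e_{v-1}+\dots+e_{v-u}}$). Digit indices in the first subscript are taken modulo $\tau$. -}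

module Defs where

open import Data.Nat as ℕ using (ℕ)
open import Data.Nat.Coprimality using (Coprime)
open import Data.Integer as ℤ using (ℤ; +_)
open import Data.Integer.Divisibility using (_∣_)
open import Data.Rational as ℚ using (ℚ; _/_)
open import Data.Product using (Σ; _×_)
open import Relation.Binary.PropositionalEquality using (_≡_)

ι : ℤ → ℚ
ι z = z / 1

InZml : ℕ → ℕ → ℚ → Set
InZml m l q = Coprime (ℚ.denominatorℕ q) m × Coprime (ℚ.denominatorℕ q) l

ModEq : ℤ → ℤ → ℕ → Set
ModEq x y M = (+ M) ∣ (x ℤ.- y)

ModEqZml : ℕ → ℕ → ℚ → ℚ → ℕ → Set
ModEqZml m l q q' M = Σ ℚ (λ t → InZml m l t × (q ℚ.- q' ≡ ι (+ M) ℚ.* t))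

IsInvMod : ℤ → ℤ → ℕ → Set
IsInvMod x w M = ModEq (w ℤ.* x) (+ 1) M

Periodic : {A : Set} → ℕ → (ℤ → A) → Set
Periodic τ g = ∀ v → g (v ℤ.+ + τ) ≡ g v

module Submission where

-- Writing k_{v,u}, j_{v,u} for the tails of the two expansions, the heart of
-- the proof is the invariant j_{v+u,u} = k_{v,u}: the l-adic tail of n_{v+u}
-- at depth u is the m-adic tail of n_v at depth u.  It is trivial for u = 0
-- and holds for u = 1 since n_v = M_v·t_v + s_v and n_{v+1} = L_v·t_v + r_v
-- share the tail t_v.  Powers of m and l are coprime to every admissible
-- denominator, so a step y ↦ P·y + c (c < P, y ∈ ℤ_⟨m,l⟩) determines c and y.
-- Expanding a common tail in both ways and comparing yields the integral
-- carry identity L_v·d_{v,u+1} + b_{v+u+1,u} - d_{v+1,u} = c·M_{v+u+1}, which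
-- gives the next case of the invariant and, after multiplying by an inverse
-- of L_v, the m-adic congruence; the symmetric comparison gives the l-adic one.

open import Defs
open import Data.Nat as ℕ using (ℕ; zero; suc; _^_; _∸_; _⊔_)
import Data.Nat.Properties as ℕP
open import Data.Nat.Coprimality using (Coprime)
import Data.Nat.Coprimality as Cop
import Data.Nat.Divisibility as ℕD
open import Data.Integer as ℤ using (ℤ; +_; -_; ∣_∣; -[1+_])
import Data.Integer.Properties as ℤP
open import Data.Integer.Divisibility using (_∣_)
import Data.Integer.Divisibility.Signed as ℤS
open import Data.Integer.Tactic.RingSolver using () renaming (solve to ℤ-solve)
open import Data.List using (_∷_; [])
open import Data.Rational as ℚ using (ℚ; mkℚ)
import Data.Rational.Properties as ℚP
import Data.Rational.Unnormalised as ℚᵘ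
import Data.Rational.Unnormalised.Properties as ℚᵘP
open import Data.Rational.Solver using (module +-*-Solver)
open +-*-Solver using (_:+_; _:*_; _:-_; _:=_) renaming (solve to ℚ-solve)
open import Data.Product using (Σ; _×_; _,_; proj₁; proj₂)
open import Data.Empty using (⊥; ⊥-elim)
open import Relation.Binary.PropositionalEquality
open import Relation.Nullary using (¬_; yes; no)

ι-toℚᵘ : ∀ z → ℚ.toℚᵘ (ι z) ℚᵘ.≃ ℚᵘ.mkℚᵘ z 0
ι-toℚᵘ z = ℚP.toℚᵘ-fromℚᵘ (ℚᵘ.mkℚᵘ z 0)

ι-+ : ∀ x y → ι (x ℤ.+ y) ≡ ι x ℚ.+ ι y
ι-+ x y = ℚP.toℚᵘ-injective (begin
  ℚ.toℚᵘ (ι (x ℤ.+ y))                    ≈⟨ ι-toℚᵘ (x ℤ.+ y) ⟩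
  ℚᵘ.mkℚᵘ (x ℤ.+ y) 0                     ≈⟨ ℚᵘ.*≡* (cong (ℤ._* + 1) (cong₂ ℤ._+_ (sym (ℤP.*-identityʳ x)) (sym (ℤP.*-identityʳ y)))) ⟩
  ℚᵘ.mkℚᵘ x 0 ℚᵘ.+ ℚᵘ.mkℚᵘ y 0            ≈⟨ ℚᵘP.+-cong (ι-toℚᵘ x) (ι-toℚᵘ y) ⟨
  ℚ.toℚᵘ (ι x) ℚᵘ.+ ℚ.toℚᵘ (ι y)          ≈⟨ ℚP.toℚᵘ-homo-+ (ι x) (ι y) ⟨
  ℚ.toℚᵘ (ι x ℚ.+ ι y)                    ∎)
  where open ℚᵘP.≃-Reasoning

ι-* : ∀ x y → ι (x ℤ.* y) ≡ ι x ℚ.* ι y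
ι-* x y = ℚP.toℚᵘ-injective (begin
  ℚ.toℚᵘ (ι (x ℤ.* y))                    ≈⟨ ι-toℚᵘ (x ℤ.* y) ⟩
  ℚᵘ.mkℚᵘ x 0 ℚᵘ.* ℚᵘ.mkℚᵘ y 0            ≈⟨ ℚᵘP.*-cong (ι-toℚᵘ x) (ι-toℚᵘ y) ⟨
  ℚ.toℚᵘ (ι x) ℚᵘ.* ℚ.toℚᵘ (ι y)          ≈⟨ ℚP.toℚᵘ-homo-* (ι x) (ι y) ⟨
  ℚ.toℚᵘ (ι x ℚ.* ι y)                    ∎)
  where open ℚᵘP.≃-Reasoning

ι-neg : ∀ x → ι (- x) ≡ ℚ.- ι x
ι-neg x = ℚP.toℚᵘ-injective (begin
  ℚ.toℚᵘ (ι (- x))          ≈⟨ ι-toℚᵘ (- x) ⟩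
  ℚᵘ.- ℚᵘ.mkℚᵘ x 0          ≈⟨ ℚᵘP.-‿cong (ι-toℚᵘ x) ⟨
  ℚᵘ.- ℚ.toℚᵘ (ι x)         ≈⟨ ℚP.toℚᵘ-homo‿- (ι x) ⟨
  ℚ.toℚᵘ (ℚ.- ι x)          ∎)
  where open ℚᵘP.≃-Reasoning

ι-- : ∀ x y → ι (x ℤ.- y) ≡ ι x ℚ.- ι y
ι-- x y = trans (ι-+ x (- y)) (cong (ι x ℚ.+_) (ι-neg y))

ι-injective : ∀ {x y} → ι x ≡ ι y → x ≡ y
ι-injective {x} {y} eq with ℚᵘP.≃-trans (ℚᵘP.≃-sym (ι-toℚᵘ x)) (ℚᵘP.≃-trans (ℚᵘP.≃-reflexive (cong ℚ.toℚᵘ eq)) (ι-toℚᵘ y))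
... | ℚᵘ.*≡* x*1≡y*1 = trans (sym (ℤP.*-identityʳ x)) (trans x*1≡y*1 (ℤP.*-identityʳ y))

ι-cancelʳ : ∀ {x y} P → 1 ℕ.≤ P → x ℚ.* ι (+ P) ≡ y ℚ.* ι (+ P) → x ≡ y
ι-cancelʳ {x} {y} P@(suc _) _ eq = begin
    x                      ≡⟨ ℚP.*-identityʳ x ⟨
    x ℚ.* ℚ.1ℚ             ≡⟨ cong (x ℚ.*_) (ℚP.*-inverseʳ p) ⟨
    x ℚ.* (p ℚ.* ℚ.1/ p)   ≡⟨ ℚP.*-assoc x p (ℚ.1/ p) ⟨
    x ℚ.* p ℚ.* ℚ.1/ p     ≡⟨ cong (ℚ._* ℚ.1/ p) eq ⟩
    y ℚ.* p ℚ.* ℚ.1/ p     ≡⟨ ℚP.*-assoc y p (ℚ.1/ p) ⟩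
    y ℚ.* (p ℚ.* ℚ.1/ p)   ≡⟨ cong (y ℚ.*_) (ℚP.*-inverseʳ p) ⟩
    y ℚ.* ℚ.1ℚ             ≡⟨ ℚP.*-identityʳ y ⟩
    y                      ∎
  where
  open ≡-Reasoning
  p : ℚ
  p = ι (+ P)
  instance
    p≢0 : ℚ.NonZero p
    p≢0 = ℚ.≢-nonZero (λ p≡0 → ℕP.1+n≢0 (ℤP.+-injective (ι-injective {+ P} {+ 0} p≡0)))

coprime-*ʳ : ∀ {d p q} → Coprime d p → Coprime d q → Coprime d (p ℕ.* q)
coprime-*ʳ {d} {p} {q} d⊥p d⊥q {i} (i∣d , i∣pq) = d⊥q (i∣d , i∣q)
  where
  i⊥p : Coprime i p
  i⊥p (j∣i , j∣p) = d⊥p (ℕD.∣-trans j∣i i∣d , j∣p)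
  i∣q : i ℕD.∣ q
  i∣q = Cop.coprime-divisor i⊥p i∣pq

coprime-*ˡ : ∀ {d₁ d₂ p} → Coprime d₁ p → Coprime d₂ p → Coprime (d₁ ℕ.* d₂) p
coprime-*ˡ d₁⊥p d₂⊥p = Cop.sym (coprime-*ʳ (Cop.sym d₁⊥p) (Cop.sym d₂⊥p))

coprime-^ʳ : ∀ {d p} x → Coprime d p → Coprime d (p ^ x)
coprime-^ʳ {d} zero    _   = Cop.sym (Cop.1-coprimeTo d)
coprime-^ʳ     (suc x) d⊥p = coprime-*ʳ d⊥p (coprime-^ʳ x d⊥p)

-- Unlike InZml, the
-- denominator D need not be the reduced one, which makes closure under
-- the ring operations immediate.
record Local (m l : ℕ) (q : ℚ) : Set where
  field
    den     : ℕ
    num     : ℤ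
    den⊥m   : Coprime den m
    den⊥l   : Coprime den l
    cleared : q ℚ.* ι (+ den) ≡ ι num

InZml⇒Local : ∀ {m l q} → InZml m l q → Local m l q
InZml⇒Local {q = q@(mkℚ N d _)} (d⊥m , d⊥l) = record
  { den = suc d ; num = N ; den⊥m = d⊥m ; den⊥l = d⊥l ; cleared = q*d≡N }
  where
  q*d≡N : q ℚ.* ι (+ suc d) ≡ ι N
  q*d≡N = ℚP.toℚᵘ-injective (begin
    ℚ.toℚᵘ (q ℚ.* ι (+ suc d))                 ≈⟨ ℚP.toℚᵘ-homo-* q (ι (+ suc d)) ⟩
    ℚᵘ.mkℚᵘ N d ℚᵘ.* ℚ.toℚᵘ (ι (+ suc d))      ≈⟨ ℚᵘP.*-congˡ {ℚᵘ.mkℚᵘ N d} (ι-toℚᵘ (+ suc d)) ⟩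
    ℚᵘ.mkℚᵘ N d ℚᵘ.* ℚᵘ.mkℚᵘ (+ suc d) 0       ≈⟨ ℚᵘ.*≡* (trans (ℤP.*-identityʳ _) (cong (N ℤ.*_) (cong (λ x → + suc x) (sym (ℕP.*-identityʳ d))))) ⟩
    ℚᵘ.mkℚᵘ N 0                                ≈⟨ ι-toℚᵘ N ⟨
    ℚ.toℚᵘ (ι N)                               ∎)
    where open ℚᵘP.≃-Reasoning

Local-− : ∀ {m l x y} → Local m l x → Local m l y → Local m l (x ℚ.- y)
Local-− {x = x} {y} lx ly = record
  { den = Dx ℕ.* Dy ; num = Nx ℤ.* + Dy ℤ.- Ny ℤ.* + Dx
  ; den⊥m = coprime-*ˡ (den⊥m lx) (den⊥m ly) ; den⊥l = coprime-*ˡ (den⊥l lx) (den⊥l ly)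
  ; cleared = begin
      (x ℚ.- y) ℚ.* ι (+ (Dx ℕ.* Dy))           ≡⟨ cong (λ D → (x ℚ.- y) ℚ.* ι D) (ℤP.pos-* Dx Dy) ⟩
      (x ℚ.- y) ℚ.* ι (+ Dx ℤ.* + Dy)           ≡⟨ cong ((x ℚ.- y) ℚ.*_) (ι-* (+ Dx) (+ Dy)) ⟩
      (x ℚ.- y) ℚ.* (ι (+ Dx) ℚ.* ι (+ Dy))     ≡⟨ ℚ-solve 4 (λ x y A B → (x :- y) :* (A :* B) := x :* A :* B :- y :* B :* A) refl x y (ι (+ Dx)) (ι (+ Dy)) ⟩
      x ℚ.* ι (+ Dx) ℚ.* ι (+ Dy) ℚ.- y ℚ.* ι (+ Dy) ℚ.* ι (+ Dx)
                                                ≡⟨ cong₂ (λ a b → a ℚ.* ι (+ Dy) ℚ.- b ℚ.* ι (+ Dx)) (cleared lx) (cleared ly) ⟩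
      ι Nx ℚ.* ι (+ Dy) ℚ.- ι Ny ℚ.* ι (+ Dx)   ≡⟨ cong₂ ℚ._-_ (ι-* Nx (+ Dy)) (ι-* Ny (+ Dx)) ⟨
      ι (Nx ℤ.* + Dy) ℚ.- ι (Ny ℤ.* + Dx)       ≡⟨ ι-- (Nx ℤ.* + Dy) (Ny ℤ.* + Dx) ⟨
      ι (Nx ℤ.* + Dy ℤ.- Ny ℤ.* + Dx)           ∎ }
  where
  open Local
  open ≡-Reasoning
  Dx Dy : ℕ
  Dx = den lx
  Dy = den ly
  Nx Ny : ℤ
  Nx = num lx
  Ny = num ly

Local-scale : ∀ {m l x} c → Local m l x → Local m l (ι c ℚ.* x)
Local-scale {x = x} c lx = record
  { den = den lx ; num = c ℤ.* num lx ; den⊥m = den⊥m lx ; den⊥l = den⊥l lx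
  ; cleared = begin
      ι c ℚ.* x ℚ.* ι (+ den lx)     ≡⟨ ℚP.*-assoc (ι c) x (ι (+ den lx)) ⟩
      ι c ℚ.* (x ℚ.* ι (+ den lx))   ≡⟨ cong (ι c ℚ.*_) (cleared lx) ⟩
      ι c ℚ.* ι (num lx)             ≡⟨ ι-* c (num lx) ⟨
      ι (c ℤ.* num lx)               ∎ }
  where
  open Local
  open ≡-Reasoning

-- P is coprime to every admissible denominator of ℤ_⟨m,l⟩; for P ≥ 1
-- this says that division by P is detected by integrality.
AvoidsDenominators : ℕ → ℕ → ℕ → Set
AvoidsDenominators m l P = ∀ D → Coprime D m → Coprime D l → Coprime P D

powers-of-m-avoid : ∀ {m l} x → AvoidsDenominators m l (m ^ x)
powers-of-m-avoid x D D⊥m _ = Cop.sym (coprime-^ʳ x D⊥m)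

powers-of-l-avoid : ∀ {m l} x → AvoidsDenominators m l (l ^ x)
powers-of-l-avoid x D _ D⊥l = Cop.sym (coprime-^ʳ x D⊥l)

local-integral : ∀ {m l q N} P → Local m l q → AvoidsDenominators m l P → 1 ℕ.≤ P →
                 q ℚ.* ι (+ P) ≡ ι N → Σ ℤ λ z → q ≡ ι z × N ≡ z ℤ.* + P
local-integral {q = q} {N} P lq avoids P≥1 qP≡N = z , ι-cancelʳ P P≥1 qP≡zP , N≡zP
  where
  open Local lq
  open ≡-Reasoning
  ND≡num*P : N ℤ.* + den ≡ num ℤ.* + P
  ND≡num*P = ι-injective (begin
    ι (N ℤ.* + den)             ≡⟨ ι-* N (+ den) ⟩
    ι N ℚ.* ι (+ den)           ≡⟨ cong (ℚ._* ι (+ den)) qP≡N ⟨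
    q ℚ.* ι (+ P) ℚ.* ι (+ den) ≡⟨ ℚ-solve 3 (λ q a b → q :* a :* b := q :* b :* a) refl q (ι (+ P)) (ι (+ den)) ⟩
    q ℚ.* ι (+ den) ℚ.* ι (+ P) ≡⟨ cong (ℚ._* ι (+ P)) cleared ⟩
    ι num ℚ.* ι (+ P)           ≡⟨ ι-* num (+ P) ⟨
    ι (num ℤ.* + P)             ∎)
  P∣D*N : P ℕD.∣ den ℕ.* ∣ N ∣
  P∣D*N = ℕD.divides ∣ num ∣ (begin
    den ℕ.* ∣ N ∣           ≡⟨ ℕP.*-comm den ∣ N ∣ ⟩
    ∣ N ∣ ℕ.* den           ≡⟨ ℤP.abs-* N (+ den) ⟨
    ∣ N ℤ.* + den ∣         ≡⟨ cong ∣_∣ ND≡num*P ⟩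
    ∣ num ℤ.* + P ∣         ≡⟨ ℤP.abs-* num (+ P) ⟩
    ∣ num ∣ ℕ.* P           ∎)
  P∣N : (+ P) ℤS.∣ N
  P∣N = ℤS.∣ᵤ⇒∣ (Cop.coprime-divisor (avoids den den⊥m den⊥l) P∣D*N)
  z : ℤ
  z = ℤS._∣_.quotient P∣N
  N≡zP : N ≡ z ℤ.* + P
  N≡zP = ℤS._∣_.equality P∣N
  qP≡zP : q ℚ.* ι (+ P) ≡ ι z ℚ.* ι (+ P)
  qP≡zP = trans qP≡N (trans (cong ι N≡zP) (ι-* z (+ P)))

local-difference : ∀ {m l a b} P x x' → Local m l a → Local m l b →
                   AvoidsDenominators m l P → 1 ℕ.≤ P →
                   ι (+ P) ℚ.* a ℚ.+ ι x ≡ ι (+ P) ℚ.* b ℚ.+ ι x' →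
                   Σ ℤ λ z → a ℚ.- b ≡ ι z × x' ℤ.- x ≡ z ℤ.* + P
local-difference {a = a} {b} P x x' la lb avoids P≥1 eq =
  local-integral P (Local-− la lb) avoids P≥1 (begin
    (a ℚ.- b) ℚ.* ι (+ P)
      ≡⟨ ℚ-solve 5 (λ p a b x x' → (a :- b) :* p := (p :* a :+ x) :- (p :* b :+ x') :+ (x' :- x)) refl
               (ι (+ P)) a b (ι x) (ι x') ⟩
    (ι (+ P) ℚ.* a ℚ.+ ι x) ℚ.- (ι (+ P) ℚ.* b ℚ.+ ι x') ℚ.+ (ι x' ℚ.- ι x)
      ≡⟨ cong (λ y → y ℚ.- (ι (+ P) ℚ.* b ℚ.+ ι x') ℚ.+ (ι x' ℚ.- ι x)) eq ⟩
    (ι (+ P) ℚ.* b ℚ.+ ι x') ℚ.- (ι (+ P) ℚ.* b ℚ.+ ι x') ℚ.+ (ι x' ℚ.- ι x)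
      ≡⟨ ℚ-solve 2 (λ y w → y :- y :+ w := w) refl (ι (+ P) ℚ.* b ℚ.+ ι x') (ι x' ℚ.- ι x) ⟩
    ι x' ℚ.- ι x
      ≡⟨ ι-- x' x ⟨
    ι (x' ℤ.- x) ∎)
  where open ≡-Reasoning

−≡⇒≡+ : ∀ {a b c} → a ℚ.- b ≡ c → a ≡ b ℚ.+ c
−≡⇒≡+ {a} {b} {c} a-b≡c = begin
  a                  ≡⟨ ℚ-solve 2 (λ a b → a := b :+ (a :- b)) refl a b ⟩
  b ℚ.+ (a ℚ.- b)    ≡⟨ cong (b ℚ.+_) a-b≡c ⟩
  b ℚ.+ c            ∎
  where open ≡-Reasoning

remainder-unique : ∀ {P c c'} z → c ℕ.< P → c' ℕ.< P → + c' ℤ.- + c ≡ z ℤ.* + P → z ≡ + 0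
remainder-unique {P} {c} {c'} z c<P c'<P c'-c≡zP = ℤP.∣i∣≡0⇒i≡0 (ℕP.n<1⇒n≡0 ∣z∣<1)
  where
  open ℕP.≤-Reasoning
  ∣z∣<1 : ∣ z ∣ ℕ.< 1
  ∣z∣<1 = ℕP.*-cancelʳ-< P ∣ z ∣ 1 (begin-strict
    ∣ z ∣ ℕ.* P          ≡⟨ ℤP.abs-* z (+ P) ⟨
    ∣ z ℤ.* + P ∣        ≡⟨ cong ∣_∣ c'-c≡zP ⟨
    ∣ + c' ℤ.- + c ∣     ≡⟨ cong ∣_∣ (ℤP.m-n≡m⊖n c' c) ⟩
    ∣ c' ℤ.⊖ c ∣         ≤⟨ ℤP.∣m⊝n∣≤m⊔n c' c ⟩
    c' ⊔ c               <⟨ ℕP.⊔-pres-<m c'<P c<P ⟩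
    P                    ≡⟨ ℕP.*-identityˡ P ⟨
    1 ℕ.* P              ∎)

digit-unique : ∀ {m l y y'} P c c' → Local m l y → Local m l y' → AvoidsDenominators m l P →
               c ℕ.< P → c' ℕ.< P →
               ι (+ P) ℚ.* y ℚ.+ ι (+ c) ≡ ι (+ P) ℚ.* y' ℚ.+ ι (+ c') → c ≡ c' × y ≡ y'
digit-unique {y = y} {y'} P c c' ly ly' avoids c<P c'<P eq =
  conclude (local-difference P (+ c) (+ c') ly ly' avoids (ℕP.≤-trans (ℕ.s≤s ℕ.z≤n) c<P) eq)
  where
  conclude : (Σ ℤ λ z → y ℚ.- y' ≡ ι z × + c' ℤ.- + c ≡ z ℤ.* + P) → c ≡ c' × y ≡ y'
  conclude (z , y-y'≡z , c'-c≡zP) = c≡c' , y≡y'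
    where
    z≡0 : z ≡ + 0
    z≡0 = remainder-unique z c<P c'<P c'-c≡zP
    c≡c' : c ≡ c'
    c≡c' = sym (ℤP.+-injective (ℤP.i-j≡0⇒i≡j (+ c') (+ c) (trans c'-c≡zP (cong (ℤ._* + P) z≡0))))
    y≡y' : y ≡ y'
    y≡y' = trans (−≡⇒≡+ (trans y-y'≡z (cong ι z≡0))) (ℚP.+-identityʳ y')

step-transfer : ∀ {m l A B} P Q x y c → Local m l A → Local m l B →
                AvoidsDenominators m l P → 1 ℕ.≤ P →
                ι (+ P) ℚ.* A ℚ.+ ι x ≡ ι Q ℚ.* (ι (+ P) ℚ.* B ℚ.+ ι y) ℚ.+ ι c →
                Σ ℤ λ z → A ≡ ι Q ℚ.* B ℚ.+ ι z × Q ℤ.* y ℤ.+ c ℤ.- x ≡ z ℤ.* + P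
step-transfer {A = A} {B} P Q x y c lA lB avoids P≥1 eq =
  conclude (local-difference P x (Q ℤ.* y ℤ.+ c) lA (Local-scale Q lB) avoids P≥1 regrouped)
  where
  open ≡-Reasoning
  regrouped : ι (+ P) ℚ.* A ℚ.+ ι x ≡ ι (+ P) ℚ.* (ι Q ℚ.* B) ℚ.+ ι (Q ℤ.* y ℤ.+ c)
  regrouped = begin
    ι (+ P) ℚ.* A ℚ.+ ι x                                ≡⟨ eq ⟩
    ι Q ℚ.* (ι (+ P) ℚ.* B ℚ.+ ι y) ℚ.+ ι c              ≡⟨ ℚ-solve 5 (λ p q b y c → q :* (p :* b :+ y) :+ c := p :* (q :* b) :+ (q :* y :+ c)) refl
                                                              (ι (+ P)) (ι Q) B (ι y) (ι c) ⟩
    ι (+ P) ℚ.* (ι Q ℚ.* B) ℚ.+ (ι Q ℚ.* ι y ℚ.+ ι c)    ≡⟨ cong (λ t → ι (+ P) ℚ.* (ι Q ℚ.* B) ℚ.+ t) (trans (ι-+ (Q ℤ.* y) c) (cong (ℚ._+ ι c) (ι-* Q y))) ⟨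
    ι (+ P) ℚ.* (ι Q ℚ.* B) ℚ.+ ι (Q ℤ.* y ℤ.+ c)        ∎
  conclude : (Σ ℤ λ z → A ℚ.- ι Q ℚ.* B ≡ ι z × Q ℤ.* y ℤ.+ c ℤ.- x ≡ z ℤ.* + P) →
             Σ ℤ λ z → A ≡ ι Q ℚ.* B ℚ.+ ι z × Q ℤ.* y ℤ.+ c ℤ.- x ≡ z ℤ.* + P
  conclude (z , A-QB≡z , eqz) = z , −≡⇒≡+ A-QB≡z , eqz

ℤ-−≡⇒≡+ : ∀ {a b c} → a ℤ.- b ≡ c → a ≡ c ℤ.+ b
ℤ-−≡⇒≡+ {a} {b} refl = ℤ-solve (a ∷ b ∷ [])

quotient-natural : ∀ {X d M} z → d ℕ.< M → + X ℤ.- + d ≡ z ℤ.* + M →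
                   Σ ℕ λ c → z ≡ + c × c ℕ.* M ℕ.+ d ≡ X
quotient-natural {X} {d} {M} (+ c) _ X-d≡cM = c , refl , ℤP.+-injective (begin
  + (c ℕ.* M) ℤ.+ + d    ≡⟨ cong (ℤ._+ + d) (ℤP.pos-* c M) ⟩
  + c ℤ.* + M ℤ.+ + d    ≡⟨ ℤ-−≡⇒≡+ X-d≡cM ⟨
  + X                    ∎)
  where open ≡-Reasoning
quotient-natural {X} {d} {M} -[1+ k ] d<M X-d≡-[1+k]M = ⊥-elim (ℕP.<⇒≱ d<M M≤d)
  where
  move : ∀ {A K P D} → A ≡ (- K) ℤ.* P ℤ.+ D → D ≡ A ℤ.+ K ℤ.* P
  move {K = K} {P} {D} refl = ℤ-solve (K ∷ P ∷ D ∷ [])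
  d≡X+[1+k]M : d ≡ X ℕ.+ suc k ℕ.* M
  d≡X+[1+k]M = ℤP.+-injective (trans (move {+ X} {+ suc k} {+ M} (ℤ-−≡⇒≡+ X-d≡-[1+k]M)) (cong (λ t → + X ℤ.+ t) (sym (ℤP.pos-* (suc k) M))))
  M≤d : M ℕ.≤ d
  M≤d = ℕP.≤-trans (ℕP.m≤n*m M (suc k)) (ℕP.≤-trans (ℕP.m≤n+m (suc k ℕ.* M) X) (ℕP.≤-reflexive (sym d≡X+[1+k]M)))

carry-is-digit : ∀ {L M d₀ d₁ b₁} z → d₀ ℕ.< M → d₁ ℕ.< M → b₁ ℕ.< L →
                 + (L ℕ.* d₀ ℕ.+ b₁) ℤ.- + d₁ ≡ z ℤ.* + M → Σ ℕ λ c → z ≡ + c × c ℕ.< L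
carry-is-digit {L} {M} {d₀} {d₁} {b₁} z d₀<M d₁<M b₁<L eq = bound (quotient-natural z d₁<M eq)
  where
  open ℕP.≤-Reasoning
  bound : (Σ ℕ λ c → z ≡ + c × c ℕ.* M ℕ.+ d₁ ≡ L ℕ.* d₀ ℕ.+ b₁) → Σ ℕ λ c → z ≡ + c × c ℕ.< L
  bound (c , z≡c , cM+d₁≡X) = c , z≡c , ℕP.*-cancelʳ-< M c L (begin-strict
    c ℕ.* M                ≤⟨ ℕP.m≤m+n (c ℕ.* M) d₁ ⟩
    c ℕ.* M ℕ.+ d₁         ≡⟨ cM+d₁≡X ⟩
    L ℕ.* d₀ ℕ.+ b₁        <⟨ ℕP.+-monoʳ-< (L ℕ.* d₀) b₁<L ⟩
    L ℕ.* d₀ ℕ.+ L         ≡⟨ trans (ℕP.+-comm (L ℕ.* d₀) L) (sym (ℕP.*-suc L d₀)) ⟩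
    L ℕ.* suc d₀           ≤⟨ ℕP.*-monoʳ-≤ L d₀<M ⟩
    L ℕ.* M                ∎)

solve-by-inverse : ∀ {P} Q w x y → ModEq (Q ℤ.* y) x P → IsInvMod Q w P → ModEq y (w ℤ.* x) P
solve-by-inverse {P} Q w x y Qy≡x wQ≡1 = ℤS.∣⇒∣ᵤ (subst (+ P ℤS.∣_) identity
  (ℤS.∣m∣n⇒∣m-n (ℤS.∣n⇒∣m*n w (ℤS.∣ᵤ⇒∣ Qy≡x)) (ℤS.∣n⇒∣m*n y (ℤS.∣ᵤ⇒∣ wQ≡1))))
  where
  identity : w ℤ.* (Q ℤ.* y ℤ.- x) ℤ.- y ℤ.* (w ℤ.* Q ℤ.- + 1) ≡ y ℤ.- w ℤ.* x
  identity = ℤ-solve (Q ∷ w ∷ x ∷ y ∷ [])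

overshoot : ∀ {L M s} t → s ℕ.≤ M → M ℕ.* (L ℕ.+ t) ≡ L ℕ.* s ℕ.+ (L ℕ.* (M ∸ s) ℕ.+ M ℕ.* t)
overshoot {L} {M} {s} t s≤M = begin
  M ℕ.* (L ℕ.+ t)                       ≡⟨ ℕP.*-distribˡ-+ M L t ⟩
  M ℕ.* L ℕ.+ M ℕ.* t                   ≡⟨ cong (ℕ._+ M ℕ.* t) (ℕP.*-comm M L) ⟩
  L ℕ.* M ℕ.+ M ℕ.* t                   ≡⟨ cong (λ x → L ℕ.* x ℕ.+ M ℕ.* t) (ℕP.m+[n∸m]≡n s≤M) ⟨
  L ℕ.* (s ℕ.+ (M ∸ s)) ℕ.+ M ℕ.* t     ≡⟨ cong (ℕ._+ M ℕ.* t) (ℕP.*-distribˡ-+ L s (M ∸ s)) ⟩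
  L ℕ.* s ℕ.+ L ℕ.* (M ∸ s) ℕ.+ M ℕ.* t ≡⟨ ℕP.+-assoc (L ℕ.* s) _ _ ⟩
  L ℕ.* s ℕ.+ (L ℕ.* (M ∸ s) ℕ.+ M ℕ.* t) ∎
  where open ≡-Reasoning

cancel-sum : ∀ {A G a} → A ≡ A ℤ.+ G ℤ.+ a → a ≡ - G
cancel-sum {A} {G} {a} A≡A+G+a = begin
  a                           ≡⟨ ℤ-solve (A ∷ G ∷ a ∷ []) ⟩
  A ℤ.+ G ℤ.+ a ℤ.- (A ℤ.+ G) ≡⟨ cong (ℤ._- (A ℤ.+ G)) A≡A+G+a ⟨
  A ℤ.- (A ℤ.+ G)             ≡⟨ ℤ-solve (A ∷ G ∷ []) ⟩
  - G                         ∎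
  where open ≡-Reasoning

-- If r = L + t, then a = -(L·(M - s) + M·t); for t = 0 this is
-- divisible by L, and for t ≥ 1 it is too large.
remainder-bound : ∀ {L M s r} a → + (L ℕ.* s) ≡ + (M ℕ.* r) ℤ.+ a → s ℕ.< M →
                  ∣ a ∣ ℕ.< M ⊔ L → ¬ (+ L ∣ a) → r ℕ.< L
remainder-bound {L} {M} {s} {r} a Ls≡Mr+a s<M small L∤a with r ℕP.<? L
... | yes r<L = r<L
... | no r≮L = ⊥-elim (refute (r ∸ L) (ℕP.m+[n∸m]≡n (ℕP.≮⇒≥ r≮L)))
  where
  gap : ℕ → ℕ
  gap t = L ℕ.* (M ∸ s) ℕ.+ M ℕ.* t
  a≡-gap : ∀ t → L ℕ.+ t ≡ r → a ≡ - + gap t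
  a≡-gap t refl = cancel-sum (trans Ls≡Mr+a (cong (λ x → + x ℤ.+ a) (overshoot t (ℕP.<⇒≤ s<M))))
  refute : ∀ t → L ℕ.+ t ≡ r → ⊥
  refute zero L≡r = L∤a (subst (L ℕD.∣_) ∣a∣≡gap (ℕD.∣m∣n⇒∣m+n (ℕD.m∣m*n (M ∸ s)) (ℕD.∣n⇒∣m*n M (L ℕD.∣0))))
    where
    ∣a∣≡gap : gap 0 ≡ ∣ a ∣
    ∣a∣≡gap = sym (trans (cong ∣_∣ (a≡-gap 0 L≡r)) (ℤP.∣-i∣≡∣i∣ (+ gap 0)))
  refute (suc t) L+t≡r = ℕP.<⇒≱ small (begin
    M ⊔ L                           ≤⟨ ℕP.m⊔n≤m+n M L ⟩
    M ℕ.+ L                         ≡⟨ ℕP.+-comm M L ⟩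
    L ℕ.+ M                         ≤⟨ ℕP.+-mono-≤ (ℕP.m≤m*n L (M ∸ s) {{ℕ.>-nonZero (ℕP.m<n⇒0<n∸m s<M)}}) (ℕP.m≤m*n M (suc t)) ⟩
    gap (suc t)                     ≡⟨ ℤP.∣-i∣≡∣i∣ (+ gap (suc t)) ⟨
    ∣ - + gap (suc t) ∣             ≡⟨ cong ∣_∣ (a≡-gap (suc t) L+t≡r) ⟨
    ∣ a ∣                           ∎)
    where open ℕP.≤-Reasoning

step-congruence : ∀ {P} Q y c x z → Q ℤ.* y ℤ.+ c ℤ.- x ≡ z ℤ.* + P → ModEq (Q ℤ.* y) (x ℤ.- c) P
step-congruence {P} Q y c x z eq = ℤS.∣⇒∣ᵤ (ℤS.divides z (trans rearrange eq))
  where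
  rearrange : Q ℤ.* y ℤ.- (x ℤ.- c) ≡ Q ℤ.* y ℤ.+ c ℤ.- x
  rearrange = ℤ-solve (Q ∷ y ∷ c ∷ x ∷ [])

step-congruence-neg : ∀ {P} Q y c x z → Q ℤ.* y ℤ.+ c ℤ.- x ≡ z ℤ.* + P → ModEq ((- Q) ℤ.* y) (c ℤ.- x) P
step-congruence-neg {P} Q y c x z eq =
  ℤS.∣⇒∣ᵤ (ℤS.divides (- z) (trans rearrange (trans (cong -_ eq) (ℤP.neg-distribˡ-* z (+ P)))))
  where
  rearrange : (- Q) ℤ.* y ℤ.- (c ℤ.- x) ≡ - (Q ℤ.* y ℤ.+ c ℤ.- x)
  rearrange = ℤ-solve (Q ∷ y ∷ c ∷ x ∷ [])

power-positive : ∀ {p} x → 1 ℕ.≤ p → 1 ℕ.≤ p ^ x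
power-positive {p} x p≥1 = ℕ.>-nonZero⁻¹ (p ^ x) {{ℕP.m^n≢0 p x {{ℕ.>-nonZero p≥1}}}}

divides-power : ∀ p x → 1 ℕ.≤ x → p ℕD.∣ p ^ x
divides-power p (suc x) _ = ℕD.m∣m*n (p ^ x)

index-shift : ∀ v U → v ℤ.+ (+ 1 ℤ.+ U) ≡ (v ℤ.+ + 1) ℤ.+ U
index-shift v U = ℤ-solve (v ∷ U ∷ [])

index-back : ∀ v U → v ≡ v ℤ.+ (+ 1 ℤ.+ U) ℤ.- + 1 ℤ.- U
index-back v U = ℤ-solve (v ∷ U ∷ [])

-- The graded m-adic and l-adic expansions of the iterates n_v, assuming only
-- what the argument uses: s_v < M_v, r_v < L_v, the recursion for n_v, and
-- the two expansions with tails in ℤ_⟨m,l⟩ (m, l ≥ 1 suffice here).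
module Expansions
  (m l : ℕ) (m≥1 : 1 ℕ.≤ m) (l≥1 : 1 ℕ.≤ l)
  (f e r s : ℤ → ℕ)
  (s<M : ∀ v → s v ℕ.< m ^ f v)
  (r<L : ∀ v → r v ℕ.< l ^ e v)
  (n : ℤ → ℚ)
  (n≡s : ∀ v → ModEqZml m l (n v) (ι (+ s v)) (m ^ f v))
  (n-rec : ∀ v → n (v ℤ.+ + 1) ℚ.* ι (+ (m ^ f v))
                 ≡ ι (+ (l ^ e v)) ℚ.* (n v ℚ.- ι (+ s v)) ℚ.+ ι (+ (m ^ f v ℕ.* r v)))
  (d : ℤ → ℕ → ℕ) (k : ℤ → ℕ → ℚ)
  (k₀ : ∀ v → k v 0 ≡ n v)
  (k-step : ∀ v u → k v u ≡ ι (+ (m ^ f (v ℤ.+ + u))) ℚ.* k v (suc u) ℚ.+ ι (+ d v u))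
  (d<M : ∀ v u → d v u ℕ.< m ^ f (v ℤ.+ + u))
  (k-inZml : ∀ v u → InZml m l (k v (suc u)))
  (b : ℤ → ℕ → ℕ) (j : ℤ → ℕ → ℚ)
  (j₀ : ∀ v → j v 0 ≡ n v)
  (j-step : ∀ v u → j v u ≡ ι (+ (l ^ e (v ℤ.- + 1 ℤ.- + u))) ℚ.* j v (suc u) ℚ.+ ι (+ b v u))
  (b<L : ∀ v u → b v u ℕ.< l ^ e (v ℤ.- + 1 ℤ.- + u))
  (j-inZml : ∀ v u → InZml m l (j v (suc u)))
  where

  M L : ℤ → ℕ
  M w = m ^ f w
  L w = l ^ e w

  M≥1 : ∀ w → 1 ℕ.≤ M w
  M≥1 w = power-positive (f w) m≥1

  L≥1 : ∀ w → 1 ℕ.≤ L w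
  L≥1 w = power-positive (e w) l≥1

  k-local : ∀ v u → Local m l (k v (suc u))
  k-local v u = InZml⇒Local (k-inZml v u)

  j-local : ∀ v u → Local m l (j v (suc u))
  j-local v u = InZml⇒Local (j-inZml v u)

  -- The expansion steps and digit bounds, with the subscript of the modulus
  -- given by any expression equal to the canonical one.
  m-step : ∀ v u {w} → w ≡ v ℤ.+ + u → k v u ≡ ι (+ M w) ℚ.* k v (suc u) ℚ.+ ι (+ d v u)
  m-step v u refl = k-step v u

  d<M′ : ∀ v u {w} → w ≡ v ℤ.+ + u → d v u ℕ.< M w
  d<M′ v u refl = d<M v u

  l-step : ∀ v u {w} → w ≡ v ℤ.- + 1 ℤ.- + u → j v u ≡ ι (+ L w) ℚ.* j v (suc u) ℚ.+ ι (+ b v u)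
  l-step v u refl = j-step v u

  b<L′ : ∀ v u {w} → w ≡ v ℤ.- + 1 ℤ.- + u → b v u ℕ.< L w
  b<L′ v u refl = b<L v u

  t : ℤ → ℚ
  t v = proj₁ (n≡s v)

  t-local : ∀ v → Local m l (t v)
  t-local v = InZml⇒Local (proj₁ (proj₂ (n≡s v)))

  n≡Mt+s : ∀ v → n v ≡ ι (+ M v) ℚ.* t v ℚ.+ ι (+ s v)
  n≡Mt+s v = trans (−≡⇒≡+ (proj₂ (proj₂ (n≡s v)))) (ℚP.+-comm (ι (+ s v)) _)

  n-next : ∀ v → n (v ℤ.+ + 1) ≡ ι (+ L v) ℚ.* t v ℚ.+ ι (+ r v)
  n-next v = ι-cancelʳ (M v) (M≥1 v) (begin
    n (v ℤ.+ + 1) ℚ.* ι (+ M v)                                 ≡⟨ n-rec v ⟩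
    ι (+ L v) ℚ.* (n v ℚ.- ι (+ s v)) ℚ.+ ι (+ (M v ℕ.* r v))   ≡⟨ cong₂ (λ x y → ι (+ L v) ℚ.* x ℚ.+ y) (proj₂ (proj₂ (n≡s v)))
                                                                     (trans (cong ι (ℤP.pos-* (M v) (r v))) (ι-* (+ M v) (+ r v))) ⟩
    ι (+ L v) ℚ.* (ι (+ M v) ℚ.* t v) ℚ.+ ι (+ M v) ℚ.* ι (+ r v)
      ≡⟨ ℚ-solve 4 (λ L M t r → L :* (M :* t) :+ M :* r := (L :* t :+ r) :* M) refl (ι (+ L v)) (ι (+ M v)) (t v) (ι (+ r v)) ⟩
    (ι (+ L v) ℚ.* t v ℚ.+ ι (+ r v)) ℚ.* ι (+ M v)             ∎)
    where open ≡-Reasoning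

  first-m-digit : ∀ v → d v 0 ≡ s v × k v 1 ≡ t v
  first-m-digit v = digit-unique (M v) (d v 0) (s v) (k-local v 0) (t-local v) (powers-of-m-avoid (f v))
    (d<M′ v 0 (sym (ℤP.+-identityʳ v))) (s<M v)
    (trans (sym (m-step v 0 (sym (ℤP.+-identityʳ v)))) (trans (k₀ v) (n≡Mt+s v)))

  first-l-digit : ∀ v → b (v ℤ.+ + 1) 0 ≡ r v × j (v ℤ.+ + 1) 1 ≡ t v
  first-l-digit v = digit-unique (L v) (b (v ℤ.+ + 1) 0) (r v) (j-local (v ℤ.+ + 1) 0) (t-local v) (powers-of-l-avoid (e v))
    (b<L′ (v ℤ.+ + 1) 0 (index-back v (+ 0))) (r<L v)
    (trans (sym (l-step (v ℤ.+ + 1) 0 (index-back v (+ 0)))) (trans (j₀ (v ℤ.+ + 1)) (n-next v)))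

  Agree : ℕ → ℤ → Set
  Agree u v = j (v ℤ.+ + u) u ≡ k v u

  agree-0 : ∀ v → Agree 0 v
  agree-0 v = trans (j₀ (v ℤ.+ + 0)) (trans (cong n (ℤP.+-identityʳ v)) (sym (k₀ v)))

  agree-1 : ∀ v → Agree 1 v
  agree-1 v = trans (proj₂ (first-l-digit v)) (sym (proj₂ (first-m-digit v)))

  -- The outcome of comparing the two expansions at (v, u): where the tails agree at depth u for n_{v+1} and at depth u+1 for n_v,
  -- the tail k_{v+1,u} is both an M-adic step (m-adic expansion of n_{v+1})
  -- and, through j_{v+u+1,u}, an L_v-adic step over an M-adic step (of n_v).
  Carry : ℤ → ℕ → Set
  Carry v u = Σ ℕ λ c → c ℕ.< L v
                      × k (v ℤ.+ + 1) (suc u) ≡ ι (+ L v) ℚ.* k v (suc (suc u)) ℚ.+ ι (+ c)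
                      × + L v ℤ.* + d v (suc u) ℤ.+ + b (v ℤ.+ + suc u) u ℤ.- + d (v ℤ.+ + 1) u
                          ≡ + c ℤ.* + M (v ℤ.+ + suc u)

  carry : ∀ v u → Agree u (v ℤ.+ + 1) → Agree (suc u) v → Carry v u
  carry v u agree-u agree-su =
    conclude (step-transfer (M w) (+ L v) (+ d₁) (+ d₀) (+ b₁) (k-local (v ℤ.+ + 1) u) (k-local v (suc u))
                            (powers-of-m-avoid (f w)) (M≥1 w) two-expansions)
    where
    w : ℤ
    w = v ℤ.+ + suc u
    d₀ d₁ b₁ : ℕ
    d₀ = d v (suc u)
    d₁ = d (v ℤ.+ + 1) u
    b₁ = b w u
    open ≡-Reasoning
    two-expansions : ι (+ M w) ℚ.* k (v ℤ.+ + 1) (suc u) ℚ.+ ι (+ d₁)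
                     ≡ ι (+ L v) ℚ.* (ι (+ M w) ℚ.* k v (suc (suc u)) ℚ.+ ι (+ d₀)) ℚ.+ ι (+ b₁)
    two-expansions = begin
      ι (+ M w) ℚ.* k (v ℤ.+ + 1) (suc u) ℚ.+ ι (+ d₁) ≡⟨ m-step (v ℤ.+ + 1) u (index-shift v (+ u)) ⟨
      k (v ℤ.+ + 1) u                                   ≡⟨ agree-u ⟨
      j (v ℤ.+ + 1 ℤ.+ + u) u                           ≡⟨ cong (λ x → j x u) (index-shift v (+ u)) ⟨
      j w u                                             ≡⟨ l-step w u (index-back v (+ u)) ⟩
      ι (+ L v) ℚ.* j w (suc u) ℚ.+ ι (+ b₁)            ≡⟨ cong (λ x → ι (+ L v) ℚ.* x ℚ.+ ι (+ b₁)) (trans agree-su (k-step v (suc u))) ⟩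
      ι (+ L v) ℚ.* (ι (+ M w) ℚ.* k v (suc (suc u)) ℚ.+ ι (+ d₀)) ℚ.+ ι (+ b₁) ∎
    carry-digit : ∀ z → + L v ℤ.* + d₀ ℤ.+ + b₁ ℤ.- + d₁ ≡ z ℤ.* + M w → Σ ℕ λ c → z ≡ + c × c ℕ.< L v
    carry-digit z digit-eq = carry-is-digit z (d<M v (suc u)) (d<M′ (v ℤ.+ + 1) u (index-shift v (+ u)))
      (b<L′ w u (index-back v (+ u))) (trans (cong (λ x → x ℤ.+ + b₁ ℤ.- + d₁) (ℤP.pos-* (L v) d₀)) digit-eq)
    conclude : (Σ ℤ λ z → k (v ℤ.+ + 1) (suc u) ≡ ι (+ L v) ℚ.* k v (suc (suc u)) ℚ.+ ι z
                        × + L v ℤ.* + d₀ ℤ.+ + b₁ ℤ.- + d₁ ≡ z ℤ.* + M w) → Carry v u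
    conclude (z , tail-eq , digit-eq) with carry-digit z digit-eq
    ... | c , refl , c<L = c , c<L , tail-eq , digit-eq

  -- The carry yields agreement at depth u+2: j_{v+u+2,u+1} = k_{v+1,u+1}
  -- is an L_v-adic step both in the l-adic expansion of n_{v+u+2} and, by
  -- the carry, over k_{v,u+2}; uniqueness of the tail gives the claim.
  agree-step : ∀ v u → Agree u (v ℤ.+ + 1) → Agree (suc u) v → Agree (suc u) (v ℤ.+ + 1) →
               Agree (suc (suc u)) v
  agree-step v u agree-u agree-su agree-su′ = conclude (carry v u agree-u agree-su)
    where
    w : ℤ
    w = v ℤ.+ + suc (suc u)
    open ≡-Reasoning
    conclude : Carry v u → Agree (suc (suc u)) v
    conclude (c , c<L , tail-eq , _) =
      proj₂ (digit-unique (L v) (b w (suc u)) c (j-local w (suc u)) (k-local v (suc u)) (powers-of-l-avoid (e v))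
                          (b<L′ w (suc u) (index-back v (+ suc u))) c<L (begin
        ι (+ L v) ℚ.* j w (suc (suc u)) ℚ.+ ι (+ b w (suc u)) ≡⟨ l-step w (suc u) (index-back v (+ suc u)) ⟨
        j w (suc u)                                           ≡⟨ cong (λ x → j x (suc u)) (index-shift v (+ suc u)) ⟩
        j (v ℤ.+ + 1 ℤ.+ + suc u) (suc u)                     ≡⟨ agree-su′ ⟩
        k (v ℤ.+ + 1) (suc u)                                 ≡⟨ tail-eq ⟩
        ι (+ L v) ℚ.* k v (suc (suc u)) ℚ.+ ι (+ c)           ∎))

  agree-two : ∀ u → (∀ v → Agree u v) × (∀ v → Agree (suc u) v)
  agree-two zero    = agree-0 , agree-1
  agree-two (suc u) = agree-su , λ v → agree-step v u (agree-u (v ℤ.+ + 1)) (agree-su v) (agree-su (v ℤ.+ + 1))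
    where
    agree-u : ∀ v → Agree u v
    agree-u = proj₁ (agree-two u)
    agree-su : ∀ v → Agree (suc u) v
    agree-su = proj₂ (agree-two u)

  agree : ∀ u v → Agree u v
  agree u = proj₁ (agree-two u)

  m-digit-congruence : ∀ v u (w : ℤ) → IsInvMod (+ L v) w (M (v ℤ.+ + suc u)) →
    ModEq (+ d v (suc u)) (w ℤ.* (+ d (v ℤ.+ + 1) u ℤ.- + b (v ℤ.+ + suc u) u)) (M (v ℤ.+ + suc u))
  m-digit-congruence v u w inverse =
    solve-by-inverse (+ L v) w (+ d₁ ℤ.- + b₁) (+ d₀)
      (step-congruence (+ L v) (+ d₀) (+ b₁) (+ d₁) (+ proj₁ the-carry) (proj₂ (proj₂ (proj₂ the-carry)))) inverse
    where
    d₀ d₁ b₁ : ℕ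
    d₀ = d v (suc u)
    d₁ = d (v ℤ.+ + 1) u
    b₁ = b (v ℤ.+ + suc u) u
    the-carry : Carry v u
    the-carry = carry v u (agree u (v ℤ.+ + 1)) (agree (suc u) v)

  -- With V = v - u - 1, the tail
  -- j_{v-1,u} = k_{V,u} is an L_{V-1}-adic step (l-adic expansion of n_{v-1})
  -- and an M_{v-1}-adic step over the L_{V-1}-adic step of j_{v,u+1} = k_{V,u+1}.
  -- Comparing them gives M_{v-1}·b_{v,u+1} + d_{V,u} - b_{v-1,u} = z·L_{V-1}, so
  -- b_{v,u+1} ≡ [-M_{v-1}]⁻¹ (d_{V,u} - b_{v-1,u})  (mod L_{V-1}).
  l-digit-congruence : ∀ v u (w : ℤ) → IsInvMod (- (+ M (v ℤ.- + 1))) w (L (v ℤ.- + suc u ℤ.- + 1)) →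
    ModEq (+ b v (suc u)) (w ℤ.* (+ d (v ℤ.- + suc u) u ℤ.- + b (v ℤ.- + 1) u)) (L (v ℤ.- + suc u ℤ.- + 1))
  l-digit-congruence v u w inverse =
    conclude (step-transfer (L ε) (+ M (v ℤ.- + 1)) (+ b′) (+ b₀) (+ d₀)
                            (j-local (v ℤ.- + 1) u) (j-local v (suc u)) (powers-of-l-avoid (e ε)) (L≥1 ε) two-expansions)
    where
    V ε : ℤ
    V = v ℤ.- + suc u
    ε = V ℤ.- + 1
    b₀ b′ d₀ : ℕ
    b₀ = b v (suc u)
    b′ = b (v ℤ.- + 1) u
    d₀ = d V u
    below : ∀ v U → v ℤ.- + 1 ≡ v ℤ.- (+ 1 ℤ.+ U) ℤ.+ U
    below v U = ℤ-solve (v ∷ U ∷ [])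
    above : ∀ v U → v ≡ v ℤ.- (+ 1 ℤ.+ U) ℤ.+ (+ 1 ℤ.+ U)
    above v U = ℤ-solve (v ∷ U ∷ [])
    ε-below : ∀ v U → v ℤ.- (+ 1 ℤ.+ U) ℤ.- + 1 ≡ v ℤ.- + 1 ℤ.- + 1 ℤ.- U
    ε-below v U = ℤ-solve (v ∷ U ∷ [])
    ε-above : ∀ v U → v ℤ.- (+ 1 ℤ.+ U) ℤ.- + 1 ≡ v ℤ.- + 1 ℤ.- (+ 1 ℤ.+ U)
    ε-above v U = ℤ-solve (v ∷ U ∷ [])
    open ≡-Reasoning
    two-expansions : ι (+ L ε) ℚ.* j (v ℤ.- + 1) (suc u) ℚ.+ ι (+ b′)
                     ≡ ι (+ M (v ℤ.- + 1)) ℚ.* (ι (+ L ε) ℚ.* j v (suc (suc u)) ℚ.+ ι (+ b₀)) ℚ.+ ι (+ d₀)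
    two-expansions = begin
      ι (+ L ε) ℚ.* j (v ℤ.- + 1) (suc u) ℚ.+ ι (+ b′)          ≡⟨ l-step (v ℤ.- + 1) u (ε-below v (+ u)) ⟨
      j (v ℤ.- + 1) u                                          ≡⟨ cong (λ x → j x u) (below v (+ u)) ⟩
      j (V ℤ.+ + u) u                                          ≡⟨ agree u V ⟩
      k V u                                                    ≡⟨ m-step V u (below v (+ u)) ⟩
      ι (+ M (v ℤ.- + 1)) ℚ.* k V (suc u) ℚ.+ ι (+ d₀)         ≡⟨ cong (λ x → ι (+ M (v ℤ.- + 1)) ℚ.* x ℚ.+ ι (+ d₀)) j≡k ⟨
      ι (+ M (v ℤ.- + 1)) ℚ.* j v (suc u) ℚ.+ ι (+ d₀)         ≡⟨ cong (λ x → ι (+ M (v ℤ.- + 1)) ℚ.* x ℚ.+ ι (+ d₀))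
                                                                   (l-step v (suc u) (ε-above v (+ u))) ⟩
      ι (+ M (v ℤ.- + 1)) ℚ.* (ι (+ L ε) ℚ.* j v (suc (suc u)) ℚ.+ ι (+ b₀)) ℚ.+ ι (+ d₀) ∎
      where
      j≡k : j v (suc u) ≡ k V (suc u)
      j≡k = trans (cong (λ x → j x (suc u)) (above v (+ u))) (agree (suc u) V)
    conclude : (Σ ℤ λ z → j (v ℤ.- + 1) (suc u) ≡ ι (+ M (v ℤ.- + 1)) ℚ.* j v (suc (suc u)) ℚ.+ ι z
                        × + M (v ℤ.- + 1) ℤ.* + b₀ ℤ.+ + d₀ ℤ.- + b′ ≡ z ℤ.* + L ε) →
               ModEq (+ b₀) (w ℤ.* (+ d₀ ℤ.- + b′)) (L ε)
    conclude (z , _ , digit-eq) =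
      solve-by-inverse (- (+ M (v ℤ.- + 1))) w (+ d₀ ℤ.- + b′) (+ b₀)
        (step-congruence-neg (+ M (v ℤ.- + 1)) (+ b₀) (+ d₀) (+ b′) z digit-eq) inverse


theorem4p4 :
  (m l τ : ℕ) → 2 ℕ.≤ m → 2 ℕ.≤ l → Coprime m l → 1 ℕ.≤ τ →
  (f e r s i : ℤ → ℕ) → (a : ℤ → ℕ → ℤ) →
  Periodic τ f → Periodic τ e → Periodic τ r → Periodic τ s → Periodic τ i → Periodic τ a →
  (∀ v → 1 ℕ.≤ f v) →
  (∀ v → a v 0 ≡ + 0) →
  (∀ v j → 1 ℕ.≤ j → j ℕ.< l → ModEq (a v j) (- (+ (m ^ f v ℕ.* j))) l) →
  (∀ v j → 1 ℕ.≤ j → j ℕ.< l → ¬ ((+ m) ∣ a v j)) →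
  (∀ v j → 1 ℕ.≤ j → j ℕ.< l → ¬ ((+ l) ∣ a v j)) →
  (∀ v → 1 ℕ.≤ i v × i v ℕ.< l) →
  (∀ v → 1 ℕ.≤ s v × s v ℕ.≤ m ^ f v ∸ 1) →
  (∀ v → Coprime (s v) m) →
  (∀ v → 1 ℕ.≤ e v × 1 ℕ.≤ r v) →
  (∀ v → ModEq (+ r v) (+ i v) l) →
  (∀ v → + (l ^ e v ℕ.* s v) ≡ + (m ^ f v ℕ.* r v) ℤ.+ a v (i v)) →
  (∀ v → ∣ a v (i v) ∣ ℕ.< (m ^ f v) ⊔ (l ^ e v)) →
  (n : ℤ → ℚ) → Periodic τ n →
  (∀ v → InZml m l (n v)) →
  (∀ v → ModEqZml m l (n v) (ι (+ s v)) (m ^ f v)) →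
  (∀ v → n (v ℤ.+ + 1) ℚ.* ι (+ (m ^ f v))
           ≡ ι (+ (l ^ e v)) ℚ.* (n v ℚ.- ι (+ s v)) ℚ.+ ι (+ (m ^ f v ℕ.* r v))) →
  -- graded m-adic digits d and tails k of n_v
  (d : ℤ → ℕ → ℕ) (k : ℤ → ℕ → ℚ) →
  (∀ v → k v 0 ≡ n v) →
  (∀ v u → k v u ≡ ι (+ (m ^ f (v ℤ.+ + u))) ℚ.* k v (suc u) ℚ.+ ι (+ d v u)) →
  (∀ v u → d v u ℕ.< m ^ f (v ℤ.+ + u)) →
  (∀ v u → InZml m l (k v (suc u))) →
  -- graded l-adic digits b and tails j of n_v
  (b : ℤ → ℕ → ℕ) (j : ℤ → ℕ → ℚ) →
  (∀ v → j v 0 ≡ n v) →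
  (∀ v u → j v u ≡ ι (+ (l ^ e (v ℤ.- + 1 ℤ.- + u))) ℚ.* j v (suc u) ℚ.+ ι (+ b v u)) →
  (∀ v u → b v u ℕ.< l ^ e (v ℤ.- + 1 ℤ.- + u)) →
  (∀ v u → InZml m l (j v (suc u))) →
  -- conclusion, for every v ∈ {0, …, τ-1}
  (v : ℕ) → v ℕ.< τ →
    (d (+ v) 0 ≡ s (+ v))
  × (b (+ v) 0 ≡ r (+ v ℤ.- + 1))
  × (∀ u → 1 ℕ.≤ u → (w : ℤ) → IsInvMod (+ (l ^ e (+ v))) w (m ^ f (+ v ℤ.+ + u)) →
       ModEq (+ d (+ v) u)
             (w ℤ.* (+ d (+ v ℤ.+ + 1) (u ∸ 1) ℤ.- + b (+ v ℤ.+ + u) (u ∸ 1)))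
             (m ^ f (+ v ℤ.+ + u)))
  × (∀ u → 1 ℕ.≤ u → (w : ℤ) → IsInvMod (- (+ (m ^ f (+ v ℤ.- + 1)))) w (l ^ e (+ v ℤ.- + u ℤ.- + 1)) →
       ModEq (+ b (+ v) u)
             (w ℤ.* (+ d (+ v ℤ.- + u) (u ∸ 1) ℤ.- + b (+ v ℤ.- + 1) (u ∸ 1)))
             (l ^ e (+ v ℤ.- + u ℤ.- + 1)))
theorem4p4 m l _ 2≤m 2≤l _ _ f e r s i a _ _ _ _ _ _ _ _ _ _ l∤a i-range s-range _ e-r-positive _ relation a-small
           n _ _ n≡s n-rec d k k₀ k-step d<M k-inZml b j j₀ j-step b<L j-inZml v _ =
    proj₁ (first-m-digit (+ v))
  , trans (cong (λ x → b x 0) (sym (pred-suc (+ v)))) (proj₁ (first-l-digit (+ v ℤ.- + 1)))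
  , (λ { zero () ; (suc u) _ w inverse → m-digit-congruence (+ v) u w inverse })
  , (λ { zero () ; (suc u) _ w inverse → l-digit-congruence (+ v) u w inverse })
  where
  m≥1 : 1 ℕ.≤ m
  m≥1 = ℕP.≤-trans (ℕ.s≤s ℕ.z≤n) 2≤m
  l≥1 : 1 ℕ.≤ l
  l≥1 = ℕP.≤-trans (ℕ.s≤s ℕ.z≤n) 2≤l
  s<M : ∀ w → s w ℕ.< m ^ f w
  s<M w = ℕP.m≤pred[n]⇒suc[m]≤n {{ℕ.>-nonZero (power-positive (f w) m≥1)}} (proj₂ (s-range w))
  -- r_w < l^{e_w}: the defining relation has l ∤ a_w, hence l^{e_w} ∤ a_w.
  r<L : ∀ w → r w ℕ.< l ^ e w
  r<L w = remainder-bound (a w (i w)) (relation w) (s<M w) (a-small w)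
    (λ L∣a → l∤a w (i w) (proj₁ (i-range w)) (proj₂ (i-range w))
                 (ℕD.∣-trans (divides-power l (e w) (proj₁ (e-r-positive w))) L∣a))
  pred-suc : ∀ x → x ℤ.- + 1 ℤ.+ + 1 ≡ x
  pred-suc x = ℤ-solve (x ∷ [])
  open Expansions m l m≥1 l≥1 f e r s s<M r<L n n≡s n-rec d k k₀ k-step d<M k-inZml b j j₀ j-step b<L j-inZml
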